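{- Let $\mathbf A=(A,\wedge,\vee,\neg,\backslash,0,1)$ be a residuated ortholattice. Define ${\sim}x:=x\backslash0$, $\overline x:={\sim}{\sim}x$, $x*y:=x\wedge({\sim}x\vee y)$, $x\Rightarrow_{\sim}y:={\sim}x\vee(x\wedge y)$, $\overline A:=\{\overline x:x\in A\}$, and $\overline{\mathbf A}:=(\overline A,\wedge,\vee,{\sim},\Rightarrow_{\sim},0,1)$ (with $\wedge,\vee$ the operations of $\mathbf A$). Then: (1) $\overline{\mathbf A}$ is an orthomodular lattice (with orthocomplement ${\sim}$); (2) the map $x\mapsto\overline x$ is an ortholattice homomorphism of $(A,\wedge,\vee,\neg,0,1)$ onto $(\overline A,\wedge,\vee,{\sim},0,1)$; (3) $\overline x\backslash\overline y=\overline x\Rightarrow_{\sim}\overline y$ for all $x,y\in A$.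
   Context: A residuated ortholattice is an algebra $(A,\wedge,\vee,\neg,\backslash,0,1)$ where $(A,\wedge,\vee,0,1)$ is a bounded lattice, $\neg$ is an order-reversing involution, and $x\cdot y\le z\iff y\le x\backslash z$ for all $x,y,z$, where $x\cdot y:=x\wedge(\neg x\vee y)$. An ortholattice is a bounded lattice with an order-reversing involution $'$ satisfying $x\wedge x'\approx0$; an orthomodular lattice is an ortholattice satisfying $x\le y\implies y\approx x\vee(y\wedge x')$. -}

module Defs where

open import Level using (Level; _⊔_) renaming (suc to lsuc)
open import Data.Product using (Σ; ∃; _×_; _,_)
open import Relation.Binary.PropositionalEquality using (_≡_)
open import Algebra.Lattice.Structures using (IsLattice)

record ResiduatedOrtholattice (a : Level) : Set (lsuc a) where
  infixr 7 _∧_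
  infixr 6 _∨_
  infixr 5 _\\_
  infix 4 _≤_
  field
    Carrier : Set a
    _∧_ _∨_ _\\_ : Carrier → Carrier → Carrier
    ¬ : Carrier → Carrier
    𝟘 𝟙 : Carrier
    isLattice : IsLattice _≡_ _∨_ _∧_
    𝟘-identity : ∀ x → 𝟘 ∨ x ≡ x
    𝟙-identity : ∀ x → 𝟙 ∧ x ≡ x

  _≤_ : Carrier → Carrier → Set a
  x ≤ y = x ∧ y ≡ x

  _·_ : Carrier → Carrier → Carrier
  x · y = x ∧ (¬ x ∨ y)

  field
    ¬-involutive : ∀ x → ¬ (¬ x) ≡ x
    ¬-antitone : ∀ x y → x ≤ y → ¬ y ≤ ¬ x
    residuated₁ : ∀ x y z → x · y ≤ z → y ≤ x \\ z
    residuated₂ : ∀ x y z → y ≤ x \\ z → x · y ≤ z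

  ∼ : Carrier → Carrier
  ∼ x = x \\ 𝟘

  bar : Carrier → Carrier
  bar x = ∼ (∼ x)

  _*_ : Carrier → Carrier → Carrier
  x * y = x ∧ (∼ x ∨ y)

  _⇒∼_ : Carrier → Carrier → Carrier
  x ⇒∼ y = ∼ x ∨ (x ∧ y)

  InBar : Carrier → Set a
  InBar x = ∃ λ y → x ≡ bar y

  -- (Ā, ∧, ∨, ∼, 0, 1) is an orthomodular lattice: Ā is closed under the
  -- operations (hence a sublattice of A with the inherited lattice laws),
  -- ∼ is an order-reversing involution on Ā that is an orthocomplement,
  -- and the orthomodular law holds in Ā.
  record BarIsOrthomodularLattice : Set a where
    field
      closed-∧ : ∀ x y → InBar x → InBar y → InBar (x ∧ y)
      closed-∨ : ∀ x y → InBar x → InBar y → InBar (x ∨ y)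
      closed-∼ : ∀ x → InBar x → InBar (∼ x)
      closed-⇒∼ : ∀ x y → InBar x → InBar y → InBar (x ⇒∼ y)
      closed-𝟘 : InBar 𝟘
      closed-𝟙 : InBar 𝟙
      ∼-involutive : ∀ x → InBar x → ∼ (∼ x) ≡ x
      ∼-antitone : ∀ x y → InBar x → InBar y → x ≤ y → ∼ y ≤ ∼ x
      ∼-complement : ∀ x → InBar x → x ∧ ∼ x ≡ 𝟘
      orthomodular : ∀ x y → InBar x → InBar y → x ≤ y → y ≡ x ∨ (y ∧ ∼ x)

  record BarIsOntoHomomorphism : Set a where
    field
      into : ∀ x → InBar (bar x)
      onto : ∀ y → InBar y → ∃ λ x → bar x ≡ y
      hom-∧ : ∀ x y → bar (x ∧ y) ≡ bar x ∧ bar y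
      hom-∨ : ∀ x y → bar (x ∨ y) ≡ bar x ∨ bar y
      hom-¬ : ∀ x → bar (¬ x) ≡ ∼ (bar x)
      hom-𝟘 : bar 𝟘 ≡ 𝟘
      hom-𝟙 : bar 𝟙 ≡ 𝟙

module Submission where

-- Residuation makes ∼ = _\\ 𝟘 an antitone Galois connection of A with itself, so bar = ∼∼ is a
-- closure operator. Since ¬x ≤ ∼x and ∼x ∧ ∼¬x = ∼(x ∨ ¬x) = 𝟘, one gets bar x = ∼¬x, and bar
-- preserves ∧ and ¬ by De Morgan. Preservation of ∨, orthomodularity and x̄ \\ ȳ = x̄ ⇒∼ ȳ all
-- rest on the decomposition x = x · y ∨ x · ¬y together with p · c ≤ c for closed c ≤ p.

open import Defs
open import Level using (Level)
open import Data.Product using (_×_; _,_)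
open import Relation.Binary.PropositionalEquality using (_≡_; refl; sym; trans; cong; cong₂)
open import Algebra.Lattice.Bundles using (Lattice)
open import Algebra.Lattice.Structures using (IsLattice)
import Algebra.Lattice.Properties.Lattice as LatticeProperties
import Relation.Binary.Lattice as Order
import Relation.Binary.Lattice.Properties.JoinSemilattice as JoinProperties
import Relation.Binary.Lattice.Properties.MeetSemilattice as MeetProperties
import Relation.Binary.Reasoning.PartialOrder as ≤-Reasoning

module ResiduatedOrtholatticeProperties {a : Level} (R : ResiduatedOrtholattice a) where

  private module A = ResiduatedOrtholattice R
  open A hiding (_≤_; ¬-antitone; residuated₁; residuated₂)
  open IsLattice isLattice using (∧-comm; ∧-assoc; ∧-absorbs-∨)

  private
    lattice : Lattice a a
    lattice = record
      { Carrier = Carrier ; _≈_ = _≡_ ; _∨_ = _∨_ ; _∧_ = _∧_ ; isLattice = isLattice }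

  open LatticeProperties lattice using (∨-idem; ∨-∧-orderTheoreticLattice)
  open Order.Lattice ∨-∧-orderTheoreticLattice
    using (_≤_; poset; joinSemilattice; meetSemilattice;
           x≤x∨y; y≤x∨y; ∨-least; x∧y≤x; x∧y≤y; ∧-greatest)
    renaming (refl to ≤-refl; trans to ≤-trans; antisym to ≤-antisym; reflexive to ≤-reflexive)
  open JoinProperties joinSemilattice using (∨-monotonic)
  open MeetProperties meetSemilattice using (∧-monotonic)
  open ≤-Reasoning poset

  private variable
    x y z c p q : Carrier

  𝟘-minimum : 𝟘 ≤ x
  𝟘-minimum {x} = sym (trans (cong (𝟘 ∧_) (sym (𝟘-identity x))) (∧-absorbs-∨ 𝟘 x))

  𝟙-maximum : x ≤ 𝟙
  𝟙-maximum {x} = sym (trans (∧-comm x 𝟙) (𝟙-identity x))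

  -- The library order is x ≡ x ∧ y, the reverse equation of ResiduatedOrtholattice._≤_; the axioms are transported.
  ¬-antitone : x ≤ y → ¬ y ≤ ¬ x
  ¬-antitone {x} {y} x≤y = sym (A.¬-antitone x y (sym x≤y))

  x·y≤z⇒y≤x\\z : x · y ≤ z → y ≤ x \\ z
  x·y≤z⇒y≤x\\z {x} {y} {z} le = sym (A.residuated₁ x y z (sym le))

  y≤x\\z⇒x·y≤z : y ≤ x \\ z → x · y ≤ z
  y≤x\\z⇒x·y≤z {y} {x} {z} le = sym (A.residuated₂ x y z (sym le))

  ¬-swap : x ≤ ¬ y → y ≤ ¬ x
  ¬-swap {x} {y} x≤¬y = begin
    y        ≡⟨ ¬-involutive y ⟨
    ¬ (¬ y)  ≤⟨ ¬-antitone x≤¬y ⟩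
    ¬ x      ∎

  ¬-∨ : ¬ (x ∨ y) ≡ ¬ x ∧ ¬ y
  ¬-∨ {x} {y} = ≤-antisym
    (∧-greatest (¬-antitone (x≤x∨y x y)) (¬-antitone (y≤x∨y x y)))
    (¬-swap (∨-least (¬-swap (x∧y≤x (¬ x) (¬ y))) (¬-swap (x∧y≤y (¬ x) (¬ y)))))

  ¬-∧ : ¬ (x ∧ y) ≡ ¬ x ∨ ¬ y
  ¬-∧ {x} {y} = begin-equality
    ¬ (x ∧ y)                  ≡⟨ cong ¬ (cong₂ _∧_ (¬-involutive x) (¬-involutive y)) ⟨
    ¬ (¬ (¬ x) ∧ ¬ (¬ y))      ≡⟨ cong ¬ ¬-∨ ⟨
    ¬ (¬ (¬ x ∨ ¬ y))          ≡⟨ ¬-involutive (¬ x ∨ ¬ y) ⟩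
    ¬ x ∨ ¬ y                  ∎

  ·-monotoneʳ : y ≤ z → x · y ≤ x · z
  ·-monotoneʳ y≤z = ∧-monotonic ≤-refl (∨-monotonic ≤-refl y≤z)

  -- x · _ is a left adjoint, so it preserves joins.
  ·-distribˡ-∨ : ∀ x y z → x · (y ∨ z) ≡ x · y ∨ x · z
  ·-distribˡ-∨ x y z = ≤-antisym
    (y≤x\\z⇒x·y≤z (∨-least (x·y≤z⇒y≤x\\z (x≤x∨y _ _)) (x·y≤z⇒y≤x\\z (y≤x∨y _ _))))
    (∨-least (·-monotoneʳ (x≤x∨y y z)) (·-monotoneʳ (y≤x∨y y z)))

  x∧¬x≤𝟘 : x ∧ ¬ x ≤ 𝟘
  x∧¬x≤𝟘 {x} = begin
    x ∧ ¬ x  ≤⟨ ∧-monotonic ≤-refl (x≤x∨y (¬ x) 𝟘) ⟩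
    x · 𝟘    ≤⟨ y≤x\\z⇒x·y≤z 𝟘-minimum ⟩
    𝟘        ∎

  x∨¬x≡𝟙 : x ∨ ¬ x ≡ 𝟙
  x∨¬x≡𝟙 {x} = ≤-antisym 𝟙-maximum (begin
    𝟙                    ≤⟨ ¬-swap 𝟘-minimum ⟩
    ¬ 𝟘                  ≤⟨ ¬-antitone (≤-trans (≤-reflexive ¬-∨) x∧¬x≤𝟘) ⟩
    ¬ (¬ (x ∨ ¬ x))      ≡⟨ ¬-involutive (x ∨ ¬ x) ⟩
    x ∨ ¬ x              ∎)

  x·𝟙≡x : x · 𝟙 ≡ x
  x·𝟙≡x {x} = begin-equality
    x ∧ (¬ x ∨ 𝟙)  ≡⟨ cong (x ∧_) (≤-antisym 𝟙-maximum (y≤x∨y (¬ x) 𝟙)) ⟩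
    x ∧ 𝟙          ≡⟨ 𝟙-maximum ⟨
    x              ∎

  ·-split : x · y ∨ x · ¬ y ≡ x
  ·-split {x} {y} = begin-equality
    x · y ∨ x · ¬ y  ≡⟨ ·-distribˡ-∨ x y (¬ y) ⟨
    x · (y ∨ ¬ y)    ≡⟨ cong (x ·_) x∨¬x≡𝟙 ⟩
    x · 𝟙            ≡⟨ x·𝟙≡x ⟩
    x                ∎

  x∧∼x≤𝟘 : x ∧ ∼ x ≤ 𝟘
  x∧∼x≤𝟘 {x} = ≤-trans (∧-monotonic ≤-refl (y≤x∨y (¬ x) (∼ x))) (y≤x\\z⇒x·y≤z ≤-refl)

  ¬x≤∼x : ¬ x ≤ ∼ x
  ¬x≤∼x {x} = x·y≤z⇒y≤x\\z (begin
    x ∧ (¬ x ∨ ¬ x)  ≡⟨ cong (x ∧_) (∨-idem (¬ x)) ⟩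
    x ∧ ¬ x          ≤⟨ x∧¬x≤𝟘 ⟩
    𝟘                ∎)

  ¬∼x≤x : ¬ (∼ x) ≤ x
  ¬∼x≤x {x} = ≤-trans (¬-antitone ¬x≤∼x) (≤-reflexive (¬-involutive x))

  x≤∼∼x : x ≤ ∼ (∼ x)
  x≤∼∼x {x} = x·y≤z⇒y≤x\\z (begin
    ∼ x ∧ (¬ (∼ x) ∨ x)  ≤⟨ ∧-monotonic ≤-refl (∨-least ¬∼x≤x ≤-refl) ⟩
    ∼ x ∧ x              ≡⟨ ∧-comm (∼ x) x ⟩
    x ∧ ∼ x              ≤⟨ x∧∼x≤𝟘 ⟩
    𝟘                    ∎)

  x·y≤∼x⇒y≤∼x : x · y ≤ ∼ x → y ≤ ∼ x
  x·y≤∼x⇒y≤∼x {x} {y} le =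
    x·y≤z⇒y≤x\\z (≤-trans (∧-greatest (x∧y≤x x (¬ x ∨ y)) le) x∧∼x≤𝟘)

  ∼-antitone : x ≤ y → ∼ y ≤ ∼ x
  ∼-antitone {x} {y} x≤y = x·y≤∼x⇒y≤∼x (begin
    x ∧ (¬ x ∨ ∼ y)             ≤⟨ ∧-monotonic x≤y (y≤x∨y (¬ y) (¬ x ∨ ∼ y)) ⟩
    y · (¬ x ∨ ∼ y)             ≡⟨ ·-distribˡ-∨ y (¬ x) (∼ y) ⟩
    y · ¬ x ∨ y · ∼ y           ≤⟨ ∨-least y·¬x≤¬x (≤-trans (y≤x\\z⇒x·y≤z ≤-refl) 𝟘-minimum) ⟩
    ¬ x                         ≤⟨ ¬x≤∼x ⟩
    ∼ x                         ∎)
    where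
    y·¬x≤¬x : y · ¬ x ≤ ¬ x
    y·¬x≤¬x = ≤-trans (x∧y≤y y (¬ y ∨ ¬ x)) (∨-least (¬-antitone x≤y) ≤-refl)

  ∼-galois : y ≤ ∼ x → x ≤ ∼ y
  ∼-galois y≤∼x = ≤-trans x≤∼∼x (∼-antitone y≤∼x)

  ∼∼∼x≡∼x : ∼ (∼ (∼ x)) ≡ ∼ x
  ∼∼∼x≡∼x = ≤-antisym (∼-antitone x≤∼∼x) x≤∼∼x

  ∼-∨ : ∼ (x ∨ y) ≡ ∼ x ∧ ∼ y
  ∼-∨ {x} {y} = ≤-antisym
    (∧-greatest (∼-antitone (x≤x∨y x y)) (∼-antitone (y≤x∨y x y)))
    (∼-galois (∨-least (∼-galois (x∧y≤x (∼ x) (∼ y))) (∼-galois (x∧y≤y (∼ x) (∼ y)))))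

  ∼𝟙≡𝟘 : ∼ 𝟙 ≡ 𝟘
  ∼𝟙≡𝟘 = ≤-antisym (≤-trans (∧-greatest 𝟙-maximum ≤-refl) x∧∼x≤𝟘) 𝟘-minimum

  ∼𝟘≡𝟙 : ∼ 𝟘 ≡ 𝟙
  ∼𝟘≡𝟙 = ≤-antisym 𝟙-maximum (x·y≤z⇒y≤x\\z (x∧y≤x 𝟘 (¬ 𝟘 ∨ 𝟙)))

  bar≡∼¬ : bar x ≡ ∼ (¬ x)
  bar≡∼¬ {x} = ≤-antisym (∼-antitone ¬x≤∼x) (x·y≤z⇒y≤x\\z (begin
    ∼ x ∧ (¬ (∼ x) ∨ ∼ (¬ x))  ≤⟨ ∧-monotonic ≤-refl (∨-least (≤-trans ¬∼x≤x x≤∼¬x) ≤-refl) ⟩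
    ∼ x ∧ ∼ (¬ x)              ≡⟨ ∼-∨ ⟨
    ∼ (x ∨ ¬ x)                ≡⟨ cong ∼ x∨¬x≡𝟙 ⟩
    ∼ 𝟙                        ≡⟨ ∼𝟙≡𝟘 ⟩
    𝟘                          ∎))
    where
    x≤∼¬x : x ≤ ∼ (¬ x)
    x≤∼¬x = ≤-trans (≤-reflexive (sym (¬-involutive x))) ¬x≤∼x

  bar-monotone : x ≤ y → bar x ≤ bar y
  bar-monotone x≤y = ∼-antitone (∼-antitone x≤y)

  bar-idem : bar (bar x) ≡ bar x
  bar-idem {x} = ∼∼∼x≡∼x {∼ x}

  bar-¬ : ∀ x → bar (¬ x) ≡ ∼ (bar x)
  bar-¬ x = begin-equality
    bar (¬ x)      ≡⟨ bar≡∼¬ ⟩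
    ∼ (¬ (¬ x))    ≡⟨ cong ∼ (¬-involutive x) ⟩
    ∼ x            ≡⟨ ∼∼∼x≡∼x ⟨
    ∼ (bar x)      ∎

  bar-∧ : ∀ x y → bar (x ∧ y) ≡ bar x ∧ bar y
  bar-∧ x y = begin-equality
    bar (x ∧ y)          ≡⟨ bar≡∼¬ ⟩
    ∼ (¬ (x ∧ y))        ≡⟨ cong ∼ ¬-∧ ⟩
    ∼ (¬ x ∨ ¬ y)        ≡⟨ ∼-∨ ⟩
    ∼ (¬ x) ∧ ∼ (¬ y)    ≡⟨ cong₂ _∧_ bar≡∼¬ bar≡∼¬ ⟨
    bar x ∧ bar y        ∎

  c≤p⇒p·c≤c : bar c ≡ c → c ≤ p → p · c ≤ c
  c≤p⇒p·c≤c {c} {p} closed c≤p = ≤-trans (x·y≤z⇒y≤x\\z (begin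
    ∼ c ∧ (¬ (∼ c) ∨ p · c)   ≤⟨ ∧-monotonic ≤-refl (∨-least (≤-trans ¬∼x≤x c≤p·c) ≤-refl) ⟩
    ∼ c ∧ p ∧ (¬ p ∨ c)       ≡⟨ ∧-assoc (∼ c) p (¬ p ∨ c) ⟨
    r ∧ (¬ p ∨ c)             ≤⟨ ∧-monotonic ≤-refl (∨-least ¬p≤∼r c≤∼r) ⟩
    r ∧ ∼ r                   ≤⟨ x∧∼x≤𝟘 ⟩
    𝟘                         ∎)) (≤-reflexive closed)
    where
    r : Carrier
    r = ∼ c ∧ p
    c≤p·c : c ≤ p · c
    c≤p·c = ∧-greatest c≤p (y≤x∨y (¬ p) c)
    ¬p≤∼r : ¬ p ≤ ∼ r
    ¬p≤∼r = ≤-trans (¬-antitone (x∧y≤y (∼ c) p)) ¬x≤∼x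
    c≤∼r : c ≤ ∼ r
    c≤∼r = ∼-galois (x∧y≤x (∼ c) p)

  bar-∨-closed : bar p ≡ p → bar q ≡ q → bar (p ∨ q) ≤ p ∨ q
  bar-∨-closed {p} {q} p-closed q-closed = begin
    w                                   ≡⟨ ·-split ⟨
    w · (p ∨ q) ∨ w · ¬ (p ∨ q)         ≡⟨ cong (_∨ w · ¬ (p ∨ q)) (·-distribˡ-∨ w p q) ⟩
    (w · p ∨ w · q) ∨ w · ¬ (p ∨ q)     ≤⟨ ∨-least (∨-monotonic
                                              (c≤p⇒p·c≤c p-closed (below (x≤x∨y p q)))
                                              (c≤p⇒p·c≤c q-closed (below (y≤x∨y p q))))
                                           (≤-trans w·¬[p∨q]≤𝟘 𝟘-minimum) ⟩
    p ∨ q                               ∎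
    where
    w : Carrier
    w = bar (p ∨ q)
    below : x ≤ p ∨ q → x ≤ w
    below x≤p∨q = ≤-trans x≤p∨q x≤∼∼x
    w·¬[p∨q]≤𝟘 : w · ¬ (p ∨ q) ≤ 𝟘
    w·¬[p∨q]≤𝟘 = y≤x\\z⇒x·y≤z (≤-trans ¬x≤∼x (≤-reflexive (sym ∼∼∼x≡∼x)))

  bar-∨ : ∀ x y → bar (x ∨ y) ≡ bar x ∨ bar y
  bar-∨ x y = ≤-antisym
    (≤-trans (bar-monotone (∨-monotonic x≤∼∼x x≤∼∼x)) (bar-∨-closed bar-idem bar-idem))
    (∨-least (bar-monotone (x≤x∨y x y)) (bar-monotone (y≤x∨y x y)))

  bar-𝟘 : bar 𝟘 ≡ 𝟘
  bar-𝟘 = trans (cong ∼ ∼𝟘≡𝟙) ∼𝟙≡𝟘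

  bar-𝟙 : bar 𝟙 ≡ 𝟙
  bar-𝟙 = trans (cong ∼ ∼𝟙≡𝟘) ∼𝟘≡𝟙

  InBar⇒bar≡ : InBar x → bar x ≡ x
  InBar⇒bar≡ (y , refl) = bar-idem

  InBar-∧ : InBar x → InBar y → InBar (x ∧ y)
  InBar-∧ (x , refl) (y , refl) = x ∧ y , sym (bar-∧ x y)

  InBar-∨ : InBar x → InBar y → InBar (x ∨ y)
  InBar-∨ (x , refl) (y , refl) = x ∨ y , sym (bar-∨ x y)

  InBar-∼ : InBar x → InBar (∼ x)
  InBar-∼ (x , refl) = ¬ x , sym (bar-¬ x)

  InBar-⇒∼ : InBar x → InBar y → InBar (x ⇒∼ y)
  InBar-⇒∼ x∈ y∈ = InBar-∨ (InBar-∼ x∈) (InBar-∧ x∈ y∈)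

  orthomodular : bar x ≡ x → x ≤ y → y ≡ x ∨ (y ∧ ∼ x)
  orthomodular {x} {y} closed x≤y = ≤-antisym (begin
    y                  ≡⟨ ·-split ⟨
    y · x ∨ y · ¬ x    ≤⟨ ∨-monotonic (c≤p⇒p·c≤c closed x≤y) (∧-monotonic ≤-refl ¬y∨¬x≤∼x) ⟩
    x ∨ (y ∧ ∼ x)      ∎)
    (∨-least x≤y (x∧y≤x y (∼ x)))
    where
    ¬y∨¬x≤∼x : ¬ y ∨ ¬ x ≤ ∼ x
    ¬y∨¬x≤∼x = ∨-least (≤-trans (¬-antitone x≤y) ¬x≤∼x) ¬x≤∼x

  \\≡⇒∼ : InBar p → InBar q → p \\ q ≡ p ⇒∼ q
  \\≡⇒∼ {p} {q} p∈ q∈ = ≤-antisym \\≤⇒∼ ⇒∼≤\\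
    where
    ⇒∼≤\\ : ∼ p ∨ p ∧ q ≤ p \\ q
    ⇒∼≤\\ = x·y≤z⇒y≤x\\z (begin
      p · (∼ p ∨ p ∧ q)       ≡⟨ ·-distribˡ-∨ p (∼ p) (p ∧ q) ⟩
      p · ∼ p ∨ p · (p ∧ q)   ≤⟨ ∨-least (≤-trans (y≤x\\z⇒x·y≤z ≤-refl) 𝟘-minimum)
                                   (≤-trans (c≤p⇒p·c≤c (InBar⇒bar≡ (InBar-∧ p∈ q∈)) (x∧y≤x p q))
                                            (x∧y≤y p q)) ⟩
      q                       ∎)

    r : Carrier
    r = ∼ (p ⇒∼ q)
    r≤p : r ≤ p
    r≤p = ≤-trans (∼-antitone (x≤x∨y (∼ p) (p ∧ q))) (≤-reflexive (InBar⇒bar≡ p∈))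
    \\≤⇒∼ : p \\ q ≤ ∼ p ∨ p ∧ q
    \\≤⇒∼ = ≤-trans (x·y≤∼x⇒y≤∼x (begin
      r ∧ (¬ r ∨ (p \\ q))              ≤⟨ ∧-monotonic r≤p (y≤x∨y (¬ p) (¬ r ∨ (p \\ q))) ⟩
      p · (¬ r ∨ (p \\ q))              ≡⟨ ·-distribˡ-∨ p (¬ r) (p \\ q) ⟩
      p · ¬ r ∨ p · (p \\ q)            ≤⟨ ∨-monotonic p·¬r≤¬r p·[p\\q]≤p∧q ⟩
      ¬ r ∨ p ∧ q                       ≤⟨ ∨-least ¬x≤∼x (∼-galois (∼-antitone (y≤x∨y (∼ p) (p ∧ q)))) ⟩
      ∼ r                               ∎))
      (≤-reflexive (InBar⇒bar≡ (InBar-⇒∼ p∈ q∈)))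
      where
      p·¬r≤¬r : p · ¬ r ≤ ¬ r
      p·¬r≤¬r = ≤-trans (x∧y≤y p (¬ p ∨ ¬ r)) (∨-least (¬-antitone r≤p) ≤-refl)
      p·[p\\q]≤p∧q : p · (p \\ q) ≤ p ∧ q
      p·[p\\q]≤p∧q = ∧-greatest (x∧y≤x p (¬ p ∨ (p \\ q))) (y≤x\\z⇒x·y≤z ≤-refl)

  barIsOrthomodularLattice : BarIsOrthomodularLattice
  barIsOrthomodularLattice = record
    { closed-∧ = λ _ _ → InBar-∧
    ; closed-∨ = λ _ _ → InBar-∨
    ; closed-∼ = λ _ → InBar-∼
    ; closed-⇒∼ = λ _ _ → InBar-⇒∼
    ; closed-𝟘 = 𝟘 , sym bar-𝟘
    ; closed-𝟙 = 𝟙 , sym bar-𝟙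
    ; ∼-involutive = λ _ → InBar⇒bar≡
    ; ∼-antitone = λ _ _ _ _ x≤y → sym (∼-antitone (sym x≤y))
    ; ∼-complement = λ _ _ → ≤-antisym x∧∼x≤𝟘 𝟘-minimum
    ; orthomodular = λ _ _ x∈ _ x≤y → orthomodular (InBar⇒bar≡ x∈) (sym x≤y)
    }

  barIsOntoHomomorphism : BarIsOntoHomomorphism
  barIsOntoHomomorphism = record
    { into = λ x → x , refl
    ; onto = λ { _ (x , refl) → x , refl }
    ; hom-∧ = bar-∧
    ; hom-∨ = bar-∨
    ; hom-¬ = bar-¬
    ; hom-𝟘 = bar-𝟘
    ; hom-𝟙 = bar-𝟙
    }

lemma4p5 : ∀ {a : Level} (R : ResiduatedOrtholattice a) → let open ResiduatedOrtholattice R in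
    BarIsOrthomodularLattice × BarIsOntoHomomorphism
      × (∀ x y → bar x \\ bar y ≡ bar x ⇒∼ bar y)
lemma4p5 R = barIsOrthomodularLattice , barIsOntoHomomorphism , λ x y → \\≡⇒∼ (x , refl) (y , refl)
  where open ResiduatedOrtholatticeProperties R
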